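{- Let $\mathfrak g_H,M_A,\Theta,\overline{\,\cdot\,},e,\curvearrowleft$ be as in the context. For any $\kappa\in\mathfrak g_H$, putting $K:=\overline{\Theta(\kappa)}\in M_A$, we have $\kappa=e\curvearrowleft K$.
   Context: $\mathbb K$ is a field of characteristic $0$. Noncrossing partitions (no $a,b$ in one block, $c,d$ in another with $a<c<b<d$) are identified with standard representatives on $[n]$; restrictions $P_{|X}$ are standardized; $\mathrm{NCP}(n)$: noncrossing partitions of $[n]$, $\mathrm{NCP}=\bigcup_{n\ge1}\mathrm{NCP}(n)$; $P\le Q$ means each block of $Q$ is a union of blocks of $P$. $H$ is the free associative unital algebra on $\mathrm{NCP}$ (the gap-insertion Hopf algebra of noncrossing partitions, whose coproduct is not needed here), $H_+$ the span of nonempty words; $\mathfrak g_H$ is the set of infinitesimal characters (linear $\kappa\colon H\to\mathbb K$ with $\kappa(\mathbf1)=0$ and $\kappa(xy)=0$ for $x,y\in H_+$), $G_H$ the set of characters (algebra morphisms $H\to\mathbb K$). $A$ is the free commutative unital algebra on $\mathrm{NCP}$, with $P/Q=\prod_{\tau\in Q}P_{|\tau}\in A$ for $P\le Q$; $M_A$ is the set of characters of $A$. $\rho\colon H\to H\otimes A$ is the algebra morphism $\rho(P)=\sum_{Q\in\mathrm{NCP}(n),\,Q\ge P}Q\otimes P/Q$ for $P\in\mathrm{NCP}(n)$, and for $\alpha\in H^*$, $\phi\in M_A$: $\alpha\curvearrowleft\phi:=(\alpha\otimes\phi)\circ\rho$. For $\phi\in G_H$, $\overline\phi\in M_A$ is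 the character of $A$ with the same values on $\mathrm{NCP}$; for $\kappa\in\mathfrak g_H$, $\Theta(\kappa)\in G_H$ is the unique character with $\Theta(\kappa)(P)=\kappa(P)$ for $P\in\mathrm{NCP}$. $e\in\mathfrak g_H$ satisfies $e(P)=1$ if $P\in\mathrm{NCP}$ has exactly one block and $e(P)=0$ for other $P\in\mathrm{NCP}$. -}

module Defs where

open import Level using (Level; _⊔_) renaming (suc to lsuc)
open import Data.Bool using (Bool; true; false; _∧_; _∨_; not; T; if_then_else_)
open import Data.Nat as ℕ using (ℕ; zero; suc; _≡ᵇ_; _<ᵇ_) renaming (_⊔_ to _⊔ℕ_)
open import Data.List using (List; []; _∷_; _++_; [_]; length; map; filter; concatMap; foldr; upTo; mapMaybe)
open import Data.List.Properties using (≡-dec)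
open import Data.Maybe using (Maybe; just; nothing)
open import Data.Product using (Σ; ∃; _,_; proj₁; proj₂) renaming (_×_ to _∧'_)
open import Relation.Nullary using (¬_; yes; no; does)
open import Relation.Nullary.Decidable using (T?)
open import Relation.Binary.PropositionalEquality using (_≡_; _≢_)
open import Algebra.Bundles using (CommutativeRing)

natK : ∀ {c ℓ} (R : CommutativeRing c ℓ) → ℕ → CommutativeRing.Carrier R
natK R zero = CommutativeRing.0# R
natK R (suc n) = CommutativeRing._+_ R (CommutativeRing.1# R) (natK R n)

record Field c ℓ : Set (lsuc (c ⊔ ℓ)) where
  field
    commutativeRing : CommutativeRing c ℓ
  open CommutativeRing commutativeRing public
  field
    0≉1     : ¬ (0# ≈ 1#)
    inverse : ∀ x → ¬ (x ≈ 0#) → ∃ λ y → (x * y) ≈ 1#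
    char0   : ∀ n → natK commutativeRing n ≈ 0# → n ≡ 0

-- Set partitions of [n] = {0,…,n-1} encoded as label lists:
-- position i lies in the block with label (l !! i).

at : List ℕ → ℕ → ℕ
at []       _       = 0
at (x ∷ _)  zero    = x
at (_ ∷ xs) (suc i) = at xs i

index : ℕ → List ℕ → Maybe ℕ
index x [] = nothing
index x (y ∷ ys) with x ≡ᵇ y
... | true  = just 0
... | false with index x ys
...   | just k  = just (suc k)
...   | nothing = nothing

-- standardization: relabel blocks 0,1,2,… in order of first appearance
stdGo : List ℕ → List ℕ → List ℕ
stdGo seen [] = []
stdGo seen (x ∷ xs) with index x seen
... | just k  = k ∷ stdGo seen xs
... | nothing = length seen ∷ stdGo (seen ++ [ x ]) xs

std : List ℕ → List ℕ
std = stdGo []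

isStd : List ℕ → Bool
isStd l = does (≡-dec ℕ._≟_ (std l) l)

same : List ℕ → ℕ → ℕ → Bool
same l i j = at l i ≡ᵇ at l j

allBelow : ℕ → (ℕ → Bool) → Bool
allBelow n p = foldr (λ i b → p i ∧ b) true (upTo n)

isNC : List ℕ → Bool
isNC l = allBelow n λ a → allBelow n λ c → allBelow n λ b → allBelow n λ d →
  not ((a <ᵇ c) ∧ (c <ᵇ b) ∧ (b <ᵇ d) ∧ same l a b ∧ same l c d ∧ not (same l a c))
  where n = length l

isNCP : List ℕ → Bool
isNCP l = (0 <ᵇ length l) ∧ isStd l ∧ isNC l

-- NCP = ⋃_{n≥1} NCP(n), elements are standard representatives
record NCP : Set where
  constructor ncp
  field
    list  : List ℕ
    valid : T (isNCP list)
open NCP public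

size : NCP → ℕ
size P = length (list P)

toNCP : List ℕ → Maybe NCP
toNCP l with T? (isNCP l)
... | yes p = just (ncp l p)
... | no  _ = nothing

allLists : ℕ → ℕ → List (List ℕ)
allLists zero    m = [] ∷ []
allLists (suc k) m = concatMap (λ x → map (x ∷_) (allLists k m)) (upTo m)

-- enumeration (without repetition) of NCP(n)
NCPof : ℕ → List NCP
NCPof n = mapMaybe toNCP (allLists n n)

_≤ᵇ_ : NCP → NCP → Bool
P ≤ᵇ Q = allBelow n λ i → allBelow n λ j →
  not (same (list P) i j) ∨ same (list Q) i j
  where n = size P

coarsenings : NCP → List NCP
coarsenings P = filter (λ Q → T? (P ≤ᵇ Q)) (NCPof (size P))

maxLabel : List ℕ → ℕ
maxLabel = foldr _⊔ℕ_ 0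

-- blocks of Q as lists of positions (labels of a standard rep. are 0..max)
blocks : NCP → List (List ℕ)
blocks Q = map (λ b → filter (λ i → T? (at (list Q) i ≡ᵇ b)) (upTo (size Q)))
               (upTo (suc (maxLabel (list Q))))

nBlocks : NCP → ℕ
nBlocks Q = length (blocks Q)

restrict : NCP → List ℕ → List ℕ
restrict P X = std (map (at (list P)) X)

-- P/Q = ∏_{τ∈Q} P_{|τ}, a monomial of A (a list of generators; A commutative).
-- (Restrictions of noncrossing partitions to blocks are noncrossing, so
-- toNCP never fails here.)
_/_ : NCP → NCP → List NCP
P / Q = mapMaybe (λ τ → toNCP (restrict P τ)) (blocks Q)

-- H has basis the words List NCP, so H* = functions on words.
-- A character of the free commutative algebra A is determined by an
-- arbitrary function NCP → K.  H⊗A elements = finite formal sums of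
-- (coefficient, word, monomial).

module _ {c ℓ} (F : Field c ℓ) where
  open Field F

  IsInfChar : (List NCP → Carrier) → Set ℓ
  IsInfChar κ = (κ [] ≈ 0#) ∧'
    (∀ (x y : List NCP) → x ≢ [] → y ≢ [] → κ (x ++ y) ≈ 0#)

  IsChar : (List NCP → Carrier) → Set ℓ
  IsChar φ = (φ [] ≈ 1#) ∧' (∀ (x y : List NCP) → φ (x ++ y) ≈ (φ x * φ y))

  prodK : List Carrier → Carrier
  prodK = foldr _*_ 1#

  sumK : List Carrier → Carrier
  sumK = foldr _+_ 0#

  evalA : (NCP → Carrier) → List NCP → Carrier
  evalA φ m = prodK (map φ m)

  HA : Set c
  HA = List (Carrier ∧' (List NCP ∧' List NCP))

  mulHA : HA → HA → HA
  mulHA xs ys = concatMap (λ { (a , u , m) →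
     map (λ { (b , v , n) → (a * b , u ++ v , m ++ n) }) ys }) xs

  ρgen : NCP → HA
  ρgen P = map (λ Q → (1# , [ Q ] , P / Q)) (coarsenings P)

  ρ : List NCP → HA
  ρ []      = (1# , [] , []) ∷ []
  ρ (P ∷ w) = mulHA (ρgen P) (ρ w)

  _↶_ : (List NCP → Carrier) → (NCP → Carrier) → List NCP → Carrier
  (α ↶ φ) w = sumK (map (λ { (a , u , m) → a * (α u * evalA φ m) }) (ρ w))

  Θ : (List NCP → Carrier) → List NCP → Carrier
  Θ κ w = prodK (map (λ P → κ [ P ]) w)

  bar : (List NCP → Carrier) → NCP → Carrier
  bar φ P = φ [ P ]

  e : List NCP → Carrier
  e [] = 0#
  e (P ∷ []) = if nBlocks P ≡ᵇ 1 then 1# else 0#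
  e (_ ∷ _ ∷ _) = 0#

-- Every term of ρ(w) has a word of the same length as w, and e vanishes off words of
-- length one, so e ↶ K vanishes wherever κ does by the infinitesimal character property.
-- On a generator P, (e ↶ K)(P) = Σ_{Q ≥ P} e(Q) K(P/Q), and among the Q ≥ P only the
-- one-block partition 1_n has e(Q) ≠ 0; since P/1_n = P this sum is K(P) = κ(P).
module Submission where

open import Defs
open import Level using (Level)
open import Algebra.Bundles using (Monoid)
open import Data.Bool using (Bool; true; false; _∨_; _∧_; not; T; if_then_else_)
open import Data.Bool.Properties using (T-irrelevant; ∧-zeroʳ; ∨-zeroʳ)
open import Data.Empty using (⊥-elim)
open import Data.List
  using (List; []; _∷_; _++_; [_]; length; map; filter; concatMap; upTo; applyUpTo; mapMaybe; catMaybes; replicate; foldr)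
open import Data.List.Properties
  using (≡-dec; map-∘; map-++; map-upTo; length-map; length-upTo; length-replicate; length-++; ++-identityʳ; filter-all)
open import Data.List.Relation.Unary.All as All using (All; []; _∷_; universal)
open import Data.List.Relation.Unary.All.Properties using (++⁺; map⁺)
open import Data.List.Relation.Unary.Any using (Any; here; there)
open import Data.Maybe using (Maybe; just; nothing; maybe)
open import Data.Nat as ℕ using (ℕ; zero; suc; _<_; _≡ᵇ_; z<s)
open import Data.Nat.Properties using (<-≤-trans; m≤m⊔n; m≤n⊔m)
open import Data.Product using (_,_; _×_)
open import Data.Unit using (tt)
open import Function using (_∘_)
open import Relation.Nullary using (yes; no)
open import Relation.Nullary.Decidable using (T?; dec-true)
open import Relation.Binary.PropositionalEquality as ≡ using (_≡_; _≢_; refl; cong; cong₂; subst)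

module ListSum {c ℓ} (M : Monoid c ℓ) where
  open Monoid M renaming (Carrier to C; refl to ≈-refl)
  open import Relation.Binary.Reasoning.Setoid setoid

  private variable
    a b : Level
    A : Set a
    B : Set b

  sum : List C → C
  sum = foldr _∙_ ε

  sum-++ : ∀ xs ys → sum (xs ++ ys) ≈ sum xs ∙ sum ys
  sum-++ []       ys = sym (identityˡ _)
  sum-++ (x ∷ xs) ys = trans (∙-congˡ (sum-++ xs ys)) (sym (assoc _ _ _))

  sum-map-map : (g : B → C) (f : A → B) (xs : List A) →
                sum (map g (map f xs)) ≡ sum (map (g ∘ f) xs)
  sum-map-map g f xs = cong sum (≡.sym (map-∘ xs))

  sum-map-ε : {g : A → C} {xs : List A} → All (λ x → g x ≈ ε) xs → sum (map g xs) ≈ ε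
  sum-map-ε []         = ≈-refl
  sum-map-ε (gx≈ε ∷ p) = trans (∙-cong gx≈ε (sum-map-ε p)) (identityˡ ε)

  sum-concatMap : (g : B → C) (f : A → List B) (xs : List A) →
                  sum (map g (concatMap f xs)) ≈ sum (map (λ x → sum (map g (f x))) xs)
  sum-concatMap g f []       = ≈-refl
  sum-concatMap g f (x ∷ xs) = begin
    sum (map g (f x ++ concatMap f xs))               ≡⟨ cong sum (map-++ g (f x) _) ⟩
    sum (map g (f x) ++ map g (concatMap f xs))       ≈⟨ sum-++ (map g (f x)) _ ⟩
    sum (map g (f x)) ∙ sum (map g (concatMap f xs))  ≈⟨ ∙-congˡ (sum-concatMap g f xs) ⟩
    sum (map (λ x → sum (map g (f x))) (x ∷ xs))      ∎

  sum-filter : (p : A → Bool) (g : A → C) (xs : List A) →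
               sum (map g (filter (λ x → T? (p x)) xs)) ≈ sum (map (λ x → if p x then g x else ε) xs)
  sum-filter p g []       = ≈-refl
  sum-filter p g (x ∷ xs) with p x
  ... | true  = ∙-congˡ (sum-filter p g xs)
  ... | false = trans (sum-filter p g xs) (sym (identityˡ _))

  sum-mapMaybe : (f : A → Maybe B) (g : B → C) (xs : List A) →
                 sum (map g (mapMaybe f xs)) ≈ sum (map (maybe g ε ∘ f) xs)
  sum-mapMaybe f g []       = ≈-refl
  sum-mapMaybe f g (x ∷ xs) with f x
  ... | just y  = ∙-congˡ (sum-mapMaybe f g xs)
  ... | nothing = trans (sum-mapMaybe f g xs) (sym (identityˡ _))

  sum-allLists : ∀ k m (h : List ℕ → C) → (∀ l → Any (0 <_) l → h l ≈ ε) →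
                 sum (map h (allLists k (suc m))) ≈ h (replicate k 0)
  sum-allLists zero    m h h-nz = identityʳ _
  sum-allLists (suc k) m h h-nz = begin
    sum (map h (concatMap (λ x → map (x ∷_) L) (upTo (suc m))))
      ≈⟨ sum-concatMap h (λ x → map (x ∷_) L) (upTo (suc m)) ⟩
    sum (map h (map (0 ∷_) L)) ∙ sum (map block (applyUpTo suc m))
      ≈⟨ ∙-cong zeroBlock (reflexive (cong (sum ∘ map block) (≡.sym (map-upTo suc m)))) ⟩
    h (replicate (suc k) 0) ∙ sum (map block (map suc (upTo m)))
      ≈⟨ ∙-congˡ (reflexive (sum-map-map block suc (upTo m))) ⟩
    h (replicate (suc k) 0) ∙ sum (map (block ∘ suc) (upTo m))
      ≈⟨ ∙-congˡ (sum-map-ε (universal sucBlock (upTo m))) ⟩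
    h (replicate (suc k) 0) ∙ ε
      ≈⟨ identityʳ _ ⟩
    h (replicate (suc k) 0) ∎
    where
    L = allLists k (suc m)
    block : ℕ → C
    block x = sum (map h (map (x ∷_) L))

    zeroBlock : block 0 ≈ h (replicate (suc k) 0)
    zeroBlock = trans (reflexive (sum-map-map h (0 ∷_) L))
                      (sum-allLists k m (h ∘ (0 ∷_)) (λ l nz → h-nz (0 ∷ l) (there nz)))

    sucBlock : ∀ y → block (suc y) ≈ ε
    sucBlock y = trans (reflexive (sum-map-map h (suc y ∷_) L))
                       (sum-map-ε (universal (λ l → h-nz (suc y ∷ l) (here z<s)) L))

at-replicate-zero : ∀ n i → at (replicate n 0) i ≡ 0
at-replicate-zero zero    i       = refl
at-replicate-zero (suc n) zero    = refl
at-replicate-zero (suc n) (suc i) = at-replicate-zero n i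

maxLabel-replicate-zero : ∀ n → maxLabel (replicate n 0) ≡ 0
maxLabel-replicate-zero zero    = refl
maxLabel-replicate-zero (suc n) = maxLabel-replicate-zero n

maxLabel-pos : ∀ {l} → Any (0 <_) l → 0 < maxLabel l
maxLabel-pos {x ∷ l} (here 0<x)  = <-≤-trans 0<x (m≤m⊔n x (maxLabel l))
maxLabel-pos {x ∷ l} (there any) = <-≤-trans (maxLabel-pos any) (m≤n⊔m x (maxLabel l))

nBlocks≡suc-maxLabel : ∀ Q → nBlocks Q ≡ suc (maxLabel (list Q))
nBlocks≡suc-maxLabel Q = ≡.trans (length-map _ (upTo (suc (maxLabel (list Q))))) (length-upTo _)

allBelow-true : ∀ n p → (∀ i → p i ≡ true) → allBelow n p ≡ true
allBelow-true n p p≡true = go (upTo n)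
  where
  go : ∀ is → foldr (λ i b → p i ∧ b) true is ≡ true
  go []       = refl
  go (i ∷ is) rewrite p≡true i = go is

toNCP-list : ∀ P → toNCP (list P) ≡ just P
toNCP-list (ncp l v) with T? (isNCP l)
... | yes v′ = cong (just ∘ ncp l) (T-irrelevant v′ v)
... | no ¬v  = ⊥-elim (¬v v)

toNCP-just⇒list : ∀ {l Q} → toNCP l ≡ just Q → list Q ≡ l
toNCP-just⇒list {l} eq with T? (isNCP l)
toNCP-just⇒list refl | yes _ = refl
toNCP-just⇒list ()   | no _

std-isStd : ∀ l → T (isStd l) → std l ≡ l
std-isStd l t with ≡-dec ℕ._≟_ (std l) l
... | yes eq = eq
... | no _   = ⊥-elim t

isNCP⇒isStd : ∀ l → T (isNCP l) → T (isStd l)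
isNCP⇒isStd (x ∷ xs) v with isStd (x ∷ xs)
... | true  = tt
... | false = v

applyUpTo-at : ∀ l → applyUpTo (at l) (length l) ≡ l
applyUpTo-at []       = refl
applyUpTo-at (x ∷ xs) = cong (x ∷_) (applyUpTo-at xs)

restrict-all : ∀ P → restrict P (upTo (size P)) ≡ list P
restrict-all (ncp l v) = ≡.trans (cong std (≡.trans (map-upTo (at l) (length l)) (applyUpTo-at l)))
                                 (std-isStd l (isNCP⇒isStd l v))

stdGo-replicate-zero : ∀ n → stdGo (0 ∷ []) (replicate n 0) ≡ replicate n 0
stdGo-replicate-zero zero    = refl
stdGo-replicate-zero (suc n) = cong (0 ∷_) (stdGo-replicate-zero n)

isNC-replicate-zero : ∀ n → isNC (replicate n 0) ≡ true
isNC-replicate-zero n =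
  allBelow-true L _ λ a → allBelow-true L _ λ c → allBelow-true L _ λ b → allBelow-true L _ λ d →
  noCrossing a b c d
  where
  rep = replicate n 0
  L = length rep
  noCrossing : ∀ a b c d →
    not ((a ℕ.<ᵇ c) ∧ (c ℕ.<ᵇ b) ∧ (b ℕ.<ᵇ d) ∧ same rep a b ∧ same rep c d ∧ not (same rep a c)) ≡ true
  noCrossing a b c d
    rewrite at-replicate-zero n a | at-replicate-zero n b | at-replicate-zero n c | at-replicate-zero n d
          | ∧-zeroʳ (b ℕ.<ᵇ d) | ∧-zeroʳ (c ℕ.<ᵇ b) | ∧-zeroʳ (a ℕ.<ᵇ c) = refl

oneBlock-valid : ∀ n → T (isNCP (replicate (suc n) 0))
oneBlock-valid n
  rewrite dec-true (≡-dec ℕ._≟_ (std (replicate (suc n) 0)) (replicate (suc n) 0))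
                   (cong (0 ∷_) (stdGo-replicate-zero n))
        | isNC-replicate-zero (suc n) = tt

oneBlock : ℕ → NCP
oneBlock n = ncp (replicate (suc n) 0) (oneBlock-valid n)

≤ᵇ-oneBlock : ∀ P n → (P ≤ᵇ oneBlock n) ≡ true
≤ᵇ-oneBlock P n = allBelow-true (size P) _ λ i → allBelow-true (size P) _ λ j → finer i j
  where
  finer : ∀ i j → not (same (list P) i j) ∨ same (replicate (suc n) 0) i j ≡ true
  finer i j rewrite at-replicate-zero (suc n) i | at-replicate-zero (suc n) j = ∨-zeroʳ _

maxLabel-oneBlock : ∀ n → maxLabel (list (oneBlock n)) ≡ 0
maxLabel-oneBlock n = maxLabel-replicate-zero (suc n)

blocks-oneBlock : ∀ n → blocks (oneBlock n) ≡ [ upTo (suc n) ]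
blocks-oneBlock n rewrite maxLabel-oneBlock n | length-replicate n {0} =
  cong [_] (filter-all (λ i → T? (at (replicate (suc n) 0) i ≡ᵇ 0)) (universal inZeroBlock _))
  where
  inZeroBlock : ∀ i → T (at (replicate (suc n) 0) i ≡ᵇ 0)
  inZeroBlock i rewrite at-replicate-zero (suc n) i = tt

/-oneBlock : ∀ P → P / oneBlock (ℕ.pred (size P)) ≡ [ P ]
/-oneBlock P@(ncp (_ ∷ xs) _) = begin
  mapMaybe (toNCP ∘ restrict P) (blocks (oneBlock (length xs)))
    ≡⟨ cong (mapMaybe (toNCP ∘ restrict P)) (blocks-oneBlock (length xs)) ⟩
  catMaybes [ toNCP (restrict P (upTo (size P))) ]
    ≡⟨ cong (catMaybes ∘ [_]) (≡.trans (cong toNCP (restrict-all P)) (toNCP-list P)) ⟩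
  [ P ] ∎
  where open ≡.≡-Reasoning

module _ {c ℓ} (M : Monoid c ℓ) where
  open Monoid M renaming (Carrier to C; refl to ≈-refl)
  open ListSum M
  open import Relation.Binary.Reasoning.Setoid setoid

  sum-NCPof : ∀ n (f : NCP → C) → (∀ Q → 0 < maxLabel (list Q) → f Q ≈ ε) →
              sum (map f (NCPof (suc n))) ≈ f (oneBlock n)
  sum-NCPof n f f≈ε = begin
    sum (map f (mapMaybe toNCP lists))       ≈⟨ sum-mapMaybe toNCP f lists ⟩
    sum (map (maybe f ε ∘ toNCP) lists)      ≈⟨ sum-allLists (suc n) n _ vanish ⟩
    maybe f ε (toNCP (replicate (suc n) 0))  ≡⟨ cong (maybe f ε) (toNCP-list (oneBlock n)) ⟩
    f (oneBlock n)                           ∎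
    where
    lists = allLists (suc n) (suc n)
    vanish : ∀ l → Any (0 <_) l → maybe f ε (toNCP l) ≈ ε
    vanish l nz with toNCP l in eq
    ... | nothing = ≈-refl
    ... | just Q  = f≈ε Q (subst (λ l → 0 < maxLabel l) (≡.sym (toNCP-just⇒list eq))
                                 (maxLabel-pos nz))

module _ {c ℓ} (F : Field c ℓ) where
  open Field F renaming (refl to ≈-refl)
  open ListSum +-monoid
  open import Relation.Binary.Reasoning.Setoid setoid

  Term : Set c
  Term = Carrier × List NCP × List NCP

  wordLength : Term → ℕ
  wordLength (_ , u , _) = length u

  -- The summand of (α ↶ φ) w; record patterns make it definitionally equal to the one in _↶_.
  evalTerm : (List NCP → Carrier) → (NCP → Carrier) → Term → Carrier
  evalTerm α φ (a , u , m) = a * (α u * evalA F φ m)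

  mulHA-wordLength : ∀ {i j} xs ys →
    All (λ t → wordLength t ≡ i) xs → All (λ t → wordLength t ≡ j) ys →
    All (λ t → wordLength t ≡ i ℕ.+ j) (mulHA F xs ys)
  mulHA-wordLength []                ys []       _  = []
  mulHA-wordLength ((a , u , m) ∷ xs) ys (refl ∷ ps) qs =
    ++⁺ (map⁺ (All.map (λ {(_ , v , _)} |v|≡j → ≡.trans (length-++ u) (cong (length u ℕ.+_) |v|≡j))
                       qs))
        (mulHA-wordLength xs ys ps qs)

  ρ-wordLength : ∀ w → All (λ t → wordLength t ≡ length w) (ρ F w)
  ρ-wordLength []      = refl ∷ []
  ρ-wordLength (P ∷ w) = mulHA-wordLength (ρgen F P) (ρ F w)
                           (map⁺ (universal (λ _ → refl) (coarsenings P))) (ρ-wordLength w)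

  ↶-vanishes : ∀ α φ w → (∀ u → length u ≡ length w → α u ≈ 0#) → _↶_ F α φ w ≈ 0#
  ↶-vanishes α φ w α≈0 =
    sum-map-ε (All.map (λ {(a , u , m)} |u|≡|w| → vanish a u m (α≈0 u |u|≡|w|)) (ρ-wordLength w))
    where
    vanish : ∀ a u m → α u ≈ 0# → evalTerm α φ (a , u , m) ≈ 0#
    vanish a u m αu≈0 = trans (*-congˡ (trans (*-congʳ αu≈0) (zeroˡ _))) (zeroʳ a)

  ↶-generator : ∀ α φ P →
    _↶_ F α φ [ P ] ≈ sum (map (λ Q → α [ Q ] * evalA F φ (P / Q)) (coarsenings P))
  ↶-generator α φ P = go (coarsenings P)
    where
    go : ∀ Qs →
      sum (map (evalTerm α φ) (mulHA F (map (λ Q → (1# , [ Q ] , P / Q)) Qs) [ (1# , [] , []) ]))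
        ≈ sum (map (λ Q → α [ Q ] * evalA F φ (P / Q)) Qs)
    go []       = ≈-refl
    go (Q ∷ Qs) = +-cong (trans (*-congʳ (*-identityˡ 1#)) (trans (*-identityˡ _) (*-congˡ φ[P/Q++[]])))
                         (go Qs)
      where
      φ[P/Q++[]] : evalA F φ (P / Q ++ []) ≈ evalA F φ (P / Q)
      φ[P/Q++[]] = reflexive (cong (evalA F φ) (++-identityʳ (P / Q)))

  e-offGenerator : ∀ u → length u ≢ 1 → e F u ≈ 0#
  e-offGenerator []          _     = ≈-refl
  e-offGenerator (_ ∷ [])    |u|≢1 = ⊥-elim (|u|≢1 refl)
  e-offGenerator (_ ∷ _ ∷ _) _     = ≈-refl

  e-generator : ∀ Q → e F [ Q ] ≡ (if maxLabel (list Q) ≡ᵇ 0 then 1# else 0#)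
  e-generator Q = cong (λ k → if k ≡ᵇ 1 then 1# else 0#) (nBlocks≡suc-maxLabel Q)

  e-oneBlock : ∀ n → e F [ oneBlock n ] ≡ 1#
  e-oneBlock n = ≡.trans (e-generator (oneBlock n))
                         (cong (λ k → if k ≡ᵇ 0 then 1# else 0#) (maxLabel-oneBlock n))

  e-multiBlock : ∀ Q → 0 < maxLabel (list Q) → e F [ Q ] ≡ 0#
  e-multiBlock Q pos = ≡.trans (e-generator Q) (ifZero-pos (maxLabel (list Q)) pos)
    where
    ifZero-pos : ∀ m → 0 < m → (if m ≡ᵇ 0 then 1# else 0#) ≡ 0#
    ifZero-pos (suc _) _ = refl

  e↶-offGenerator : ∀ K w → length w ≢ 1 → _↶_ F (e F) K w ≈ 0#
  e↶-offGenerator K w |w|≢1 =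
    ↶-vanishes (e F) K w (λ u |u|≡|w| → e-offGenerator u (|w|≢1 ∘ ≡.trans (≡.sym |u|≡|w|)))

  e↶-generator : ∀ K P → _↶_ F (e F) K [ P ] ≈ K P
  e↶-generator K P@(ncp (_ ∷ xs) _) = begin
    _↶_ F (e F) K [ P ]
      ≈⟨ ↶-generator (e F) K P ⟩
    sum (map term (coarsenings P))
      ≈⟨ sum-filter (P ≤ᵇ_) term (NCPof (size P)) ⟩
    sum (map coarserTerm (NCPof (suc (length xs))))
      ≈⟨ sum-NCPof +-monoid (length xs) coarserTerm multiBlock≈0 ⟩
    coarserTerm (oneBlock (length xs))
      ≡⟨ cong (if_then term (oneBlock (length xs)) else 0#) (≤ᵇ-oneBlock P (length xs)) ⟩
    e F [ oneBlock (length xs) ] * evalA F K (P / oneBlock (length xs))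
      ≡⟨ cong₂ _*_ (e-oneBlock (length xs)) (cong (evalA F K) (/-oneBlock P)) ⟩
    1# * (K P * 1#)
      ≈⟨ trans (*-identityˡ _) (*-identityʳ _) ⟩
    K P ∎
    where
    term : NCP → Carrier
    term Q = e F [ Q ] * evalA F K (P / Q)
    coarserTerm : NCP → Carrier
    coarserTerm Q = if P ≤ᵇ Q then term Q else 0#
    multiBlock≈0 : ∀ Q → 0 < maxLabel (list Q) → coarserTerm Q ≈ 0#
    multiBlock≈0 Q pos with P ≤ᵇ Q
    ... | true  = trans (*-congʳ (reflexive (e-multiBlock Q pos))) (zeroˡ _)
    ... | false = ≈-refl

mainTheorem13 : ∀ {c ℓ} (F : Field c ℓ) (κ : List NCP → Field.Carrier F) →
    IsInfChar F κ →
    ∀ (w : List NCP) → Field._≈_ F (κ w) (_↶_ F (e F) (bar F (Θ F κ)) w)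
mainTheorem13 F κ (κ[]≈0 , _) [] = trans κ[]≈0 (sym (e↶-offGenerator F (bar F (Θ F κ)) [] λ ()))
  where open Field F
mainTheorem13 F κ _ (P ∷ []) = sym (trans (e↶-generator F _ P) (*-identityʳ _))
  where open Field F
mainTheorem13 F κ (_ , κ-split) (P ∷ P′ ∷ w) =
  trans (κ-split [ P ] (P′ ∷ w) (λ ()) (λ ()))
        (sym (e↶-offGenerator F (bar F (Θ F κ)) (P ∷ P′ ∷ w) λ ()))
  where open Field F
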